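{- For any words $w_1,w_2$ over $[k]$, $M(w_1w_2)\geq M(w_1)M(w_2)$, where $w_1w_2$ is the concatenation.
   Context: For words $v\in[k]^m$ and $w\in[k]^n$, $M(v,w)$ is the number of strictly increasing functions $f\colon[m]\to[n]$ with $v[i]=w[f(i)]$ for all $i$ (the number of occurrences of $v$ as a subsequence of $w$). $M(w)=\max_v M(v,w)$ over all words $v$ over $[k]$. -}

module Defs where

open import Data.Nat using (ℕ; zero; suc; _<_; _≤_)
open import Data.Fin using (Fin; toℕ)
open import Data.List using (List; length; lookup; filter; concatMap; map; allFin; []; _∷_)
open import Data.Vec.Functional using (Vector)
open import Data.Product using (Σ; _×_; _,_)
open import Relation.Binary.PropositionalEquality using (_≡_)
open import Relation.Nullary using (Dec; yes; no)
open import Data.Nat.Properties using (_<?_)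
open import Data.Fin using (_≟_)
open import Relation.Nullary.Decidable using (_×-dec_)
open import Data.Fin.Properties using (all?)

Word : ℕ → Set
Word k = List (Fin k)

allFuns : (m n : ℕ) → List (Fin m → Fin n)
allFuns zero    n = (λ ()) ∷ []
allFuns (suc m) n =
  concatMap (λ j → map (λ g → λ { Fin.zero → j ; (Fin.suc i) → g i }) (allFuns m n)) (allFin n)

StrictlyIncreasing : {m n : ℕ} → (Fin m → Fin n) → Set
StrictlyIncreasing {m} f = (i j : Fin m) → toℕ i < toℕ j → toℕ (f i) < toℕ (f j)

IsOccurrence : {k : ℕ} (v w : Word k) → (Fin (length v) → Fin (length w)) → Set
IsOccurrence v w f = StrictlyIncreasing f × ((i : Fin (length v)) → lookup v i ≡ lookup w (f i))

isOccurrence? : {k : ℕ} (v w : Word k) (f : Fin (length v) → Fin (length w)) → Dec (IsOccurrence v w f)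
isOccurrence? v w f =
  all? (λ i → all? (λ j → dec< i j)) ×-dec all? (λ i → lookup v i ≟ lookup w (f i))
  where
  dec< : ∀ i j → Dec (toℕ i < toℕ j → toℕ (f i) < toℕ (f j))
  dec< i j with toℕ i <? toℕ j | toℕ (f i) <? toℕ (f j)
  ... | _       | yes q = yes (λ _ → q)
  ... | no ¬p   | no _  = yes (λ p → Data.Empty.⊥-elim (¬p p))
    where import Data.Empty
  ... | yes p   | no ¬q = no (λ h → ¬q (h p))

M₂ : {k : ℕ} → Word k → Word k → ℕ
M₂ v w = length (filter (isOccurrence? v w) (allFuns (length v) (length w)))

-- "c is M(w) = max_v M(v,w)": c is attained and is an upper bound.
IsM : {k : ℕ} → Word k → ℕ → Set
IsM {k} w c = Σ (Word k) (λ v → M₂ v w ≡ c) × ((v : Word k) → M₂ v w ≤ c)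

-- Gluing an occurrence g of v₁ in w₁ to an occurrence h of v₂ in w₂ gives an occurrence
-- g ⊕ h of v₁v₂ in w₁w₂, and (g, h) ↦ g ⊕ h is injective, so
-- M(v₁v₂, w₁w₂) ≥ M(v₁, w₁) M(v₂, w₂); choosing vᵢ with M(vᵢ, wᵢ) = M(wᵢ) gives the bound. Instead of an injectivity argument, which would
-- need function extensionality, the counts are unfolded along the recursion of allFuns on the
-- first value, for predicates invariant under _≗_.
module Submission where

open import Defs
open import Level using (Level)
open import Data.Nat using (ℕ; zero; suc; _*_; _+_; _≤_; _<_; z≤n)
open import Data.Nat.Properties
open import Data.Fin using (Fin; toℕ; _↑ˡ_; _↑ʳ_; cast; splitAt) renaming (zero to fzero; suc to fsuc)
open import Data.Fin.Properties using (toℕ-↑ˡ; toℕ-↑ʳ; toℕ<n; toℕ-cast; cast-is-id; cast-involutive)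
open import Data.List using (List; []; _∷_; _++_; length; lookup; filter; map; concatMap; tabulate)
open import Data.List.Properties using (length-++; filter-++; filter-≐)
open import Data.List.Relation.Binary.Sublist.Propositional using (⊆-refl)
open import Data.List.Relation.Binary.Sublist.Propositional.Properties using (filter⁺; length-mono-≤)
open import Data.Vec.Functional using (Vector) renaming (_∷_ to _◂_; _++_ to _⧺_)
open import Data.Vec.Functional.Properties using (lookup-++ˡ; lookup-++ʳ)
open import Data.Sum using (inj₁; inj₂)
open import Data.Sum.Properties using ([,]-map)
open import Data.Product using (_,_)
open import Function using (_∘_)
open import Relation.Nullary using (yes; no; contradiction)
open import Relation.Unary using (Pred; Decidable; _⊆_; _≐_)
open import Relation.Binary.Definitions using (_Respects_)
open import Relation.Binary.PropositionalEquality
open import Algebra.Properties.Semiring.Sum +-*-semiring using (sum; sum-syntax; sum-cong-≗; *-distribʳ-sum)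

private variable
  a p q : Level
  A B : Set a
  k m n m₁ m₂ n₁ n₂ : ℕ

count : {P : Pred A p} → Decidable P → List A → ℕ
count P? xs = length (filter P? xs)

module _ {P : Pred A p} {Q : Pred A q} (P? : Decidable P) (Q? : Decidable Q) where

  count-mono : P ⊆ Q → ∀ xs → count P? xs ≤ count Q? xs
  count-mono P⊆Q xs = length-mono-≤ (filter⁺ P? Q? (λ { refl → P⊆Q }) (⊆-refl {x = xs}))

  count-cong : P ≐ Q → ∀ xs → count P? xs ≡ count Q? xs
  count-cong P≐Q xs = cong length (filter-≐ P? Q? P≐Q xs)

count-[-] : {P : Pred A p} {Q : Pred B q} (P? : Decidable P) (Q? : Decidable Q) {x : A} {y : B} →
  (P x → Q y) → count P? (x ∷ []) ≤ count Q? (y ∷ [])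
count-[-] P? Q? {x} {y} Px⇒Qy with P? x | Q? y
... | yes _  | yes _  = ≤-refl
... | yes Px | no ¬Qy = contradiction (Px⇒Qy Px) ¬Qy
... | no _   | _      = z≤n

count-[-]-*-≤ : {P : Pred A p} (P? : Decidable P) {x : A} {r s : ℕ} →
  (P x → r ≤ s) → count P? (x ∷ []) * r ≤ s
count-[-]-*-≤ P? {x} {r} Px⇒r≤s with P? x
... | yes Px = ≤-trans (≤-reflexive (+-identityʳ r)) (Px⇒r≤s Px)
... | no _   = z≤n

count-++ : {P : Pred A p} (P? : Decidable P) (xs ys : List A) → count P? (xs ++ ys) ≡ count P? xs + count P? ys
count-++ P? xs ys = trans (cong length (filter-++ P? xs ys)) (length-++ (filter P? xs))

count-map : {P : Pred B p} (P? : Decidable P) (f : A → B) (xs : List A) → count P? (map f xs) ≡ count (P? ∘ f) xs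
count-map P? f []       = refl
count-map P? f (x ∷ xs) with P? (f x)
... | yes _ = cong suc (count-map P? f xs)
... | no _  = count-map P? f xs

count-concatMap-tabulate : {P : Pred B p} (P? : Decidable P) (F : A → List B) (g : Fin n → A) →
  count P? (concatMap F (tabulate g)) ≡ ∑[ j < n ] count P? (F (g j))
count-concatMap-tabulate {n = zero}  P? F g = refl
count-concatMap-tabulate {n = suc n} P? F g =
  trans (count-++ P? (F (g fzero)) _) (cong (count P? (F (g fzero)) +_) (count-concatMap-tabulate P? F (g ∘ fsuc)))

sum-mono-≤ : {f g : Vector ℕ n} → (∀ i → f i ≤ g i) → sum f ≤ sum g
sum-mono-≤ {n = zero}  f≤g = z≤n
sum-mono-≤ {n = suc n} f≤g = +-mono-≤ (f≤g fzero) (sum-mono-≤ (f≤g ∘ fsuc))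

sum-++ : ∀ m n (f : Vector ℕ (m + n)) → sum f ≡ sum (f ∘ (_↑ˡ n)) + sum (f ∘ (m ↑ʳ_))
sum-++ zero    n f = refl
sum-++ (suc m) n f = trans (cong (f fzero +_) (sum-++ m n (f ∘ fsuc))) (sym (+-assoc (f fzero) _ _))

sum-↑ˡ-≤ : ∀ m n (f : Vector ℕ (m + n)) → sum (f ∘ (_↑ˡ n)) ≤ sum f
sum-↑ˡ-≤ m n f = ≤-trans (m≤m+n _ _) (≤-reflexive (sym (sum-++ m n f)))

sum-↑ʳ-≤ : ∀ m n (f : Vector ℕ (m + n)) → sum (f ∘ (m ↑ʳ_)) ≤ sum f
sum-↑ʳ-≤ m n f = ≤-trans (m≤n+m _ _) (≤-reflexive (sym (sum-++ m n f)))

_⊕_ : (Fin m₁ → Fin n₁) → (Fin m₂ → Fin n₂) → Fin (m₁ + m₂) → Fin (n₁ + n₂)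
_⊕_ {n₁ = n₁} {n₂ = n₂} g h = (λ x → g x ↑ˡ n₂) ⧺ (λ y → n₁ ↑ʳ h y)

◂-⊕ : (j : Fin n₁) (g : Fin m₁ → Fin n₁) (h : Fin m₂ → Fin n₂) → (j ◂ g) ⊕ h ≗ (j ↑ˡ n₂) ◂ (g ⊕ h)
◂-⊕           j g h fzero    = refl
◂-⊕ {m₁ = m₁} j g h (fsuc i) = [,]-map (splitAt m₁ i)

countFuns : (m n : ℕ) {P : Pred (Fin m → Fin n) p} → Decidable P → ℕ
countFuns m n P? = count P? (allFuns m n)

◂-respects : {P : Pred (Fin (suc m) → Fin n) p} → P Respects _≗_ → (j : Fin n) → (P ∘ (j ◂_)) Respects _≗_
◂-respects resp j g≗g′ = resp λ { fzero → refl ; (fsuc i) → g≗g′ i }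

countFuns-suc : {P : Pred (Fin (suc m) → Fin n) p} (P? : Decidable P) → P Respects _≗_ →
  countFuns (suc m) n P? ≡ ∑[ j < n ] countFuns m n (P? ∘ (j ◂_))
-- allFuns prepends j by its own pattern lambda, which agrees with j ◂_ only pointwise.
countFuns-suc {m = m} {n} P? resp =
  trans (count-concatMap-tabulate {n = n} P? _ (λ j → j))
        (sum-cong-≗ {n = n} λ j → trans (count-map P? _ (allFuns m n))
                                 (count-cong _ _ (resp (λ { fzero → refl ; (fsuc i) → refl }) ,
                                                  resp (λ { fzero → refl ; (fsuc i) → refl }))
                                             (allFuns m n)))

countFuns-↑ʳ : ∀ m {n₁ n₂} {P : Pred (Fin m → Fin n₂) p} {Q : Pred (Fin m → Fin (n₁ + n₂)) q}
  (P? : Decidable P) (Q? : Decidable Q) → P Respects _≗_ → Q Respects _≗_ →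
  (∀ h → P h → Q ((n₁ ↑ʳ_) ∘ h)) → countFuns m n₂ P? ≤ countFuns m (n₁ + n₂) Q?
countFuns-↑ʳ zero P? Q? _ respQ shift = count-[-] P? Q? (respQ (λ ()) ∘ shift _)
countFuns-↑ʳ (suc m) {n₁} {n₂} P? Q? respP respQ shift = begin
  countFuns (suc m) n₂ P?                                  ≡⟨ countFuns-suc P? respP ⟩
  ∑[ j < n₂ ] countFuns m n₂ (P? ∘ (j ◂_))                 ≤⟨ sum-mono-≤ shift-tail ⟩
  ∑[ j < n₂ ] countFuns m (n₁ + n₂) (Q? ∘ ((n₁ ↑ʳ j) ◂_))  ≤⟨ sum-↑ʳ-≤ n₁ n₂ (λ j → countFuns m (n₁ + n₂) (Q? ∘ (j ◂_))) ⟩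
  ∑[ j < n₁ + n₂ ] countFuns m (n₁ + n₂) (Q? ∘ (j ◂_))     ≡⟨ countFuns-suc Q? respQ ⟨
  countFuns (suc m) (n₁ + n₂) Q?                           ∎
  where
  open ≤-Reasoning
  shift-tail : ∀ j → countFuns m n₂ (P? ∘ (j ◂_)) ≤ countFuns m (n₁ + n₂) (Q? ∘ ((n₁ ↑ʳ j) ◂_))
  shift-tail j = countFuns-↑ʳ m _ _ (◂-respects respP j) (◂-respects respQ (n₁ ↑ʳ j))
    λ h → respQ (λ { fzero → refl ; (fsuc i) → refl }) ∘ shift (j ◂ h)

countFuns-⊕ : ∀ m₁ {m₂ n₁ n₂} {P₁ : Pred (Fin m₁ → Fin n₁) p} {P₂ : Pred (Fin m₂ → Fin n₂) p}
  {Q : Pred (Fin (m₁ + m₂) → Fin (n₁ + n₂)) q}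
  (P₁? : Decidable P₁) (P₂? : Decidable P₂) (Q? : Decidable Q) →
  P₁ Respects _≗_ → P₂ Respects _≗_ → Q Respects _≗_ → (∀ g h → P₁ g → P₂ h → Q (g ⊕ h)) →
  countFuns m₁ n₁ P₁? * countFuns m₂ n₂ P₂? ≤ countFuns (m₁ + m₂) (n₁ + n₂) Q?
-- For m₁ = 0, g ⊕ h is h shifted into the upper n₂ values.
countFuns-⊕ zero {m₂} P₁? P₂? Q? _ resp₂ respQ combine =
  count-[-]-*-≤ P₁? λ P₁g → countFuns-↑ʳ m₂ P₂? Q? resp₂ respQ λ h → combine _ h P₁g
countFuns-⊕ (suc m₁) {m₂} {n₁} {n₂} P₁? P₂? Q? resp₁ resp₂ respQ combine = begin
  countFuns (suc m₁) n₁ P₁? * K                          ≡⟨ cong (_* K) (countFuns-suc P₁? resp₁) ⟩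
  (∑[ j < n₁ ] countFuns m₁ n₁ (P₁? ∘ (j ◂_))) * K       ≡⟨ *-distribʳ-sum K (λ j → countFuns m₁ n₁ (P₁? ∘ (j ◂_))) ⟩
  ∑[ j < n₁ ] (countFuns m₁ n₁ (P₁? ∘ (j ◂_)) * K)       ≤⟨ sum-mono-≤ combine-tail ⟩
  ∑[ j < n₁ ] countFuns M N (Q? ∘ ((j ↑ˡ n₂) ◂_))        ≤⟨ sum-↑ˡ-≤ n₁ n₂ (λ j → countFuns M N (Q? ∘ (j ◂_))) ⟩
  ∑[ j < N ] countFuns M N (Q? ∘ (j ◂_))                 ≡⟨ countFuns-suc Q? respQ ⟨
  countFuns (suc m₁ + m₂) N Q?                           ∎
  where
  open ≤-Reasoning
  K = countFuns m₂ n₂ P₂?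
  M = m₁ + m₂
  N = n₁ + n₂
  combine-tail : ∀ j → countFuns m₁ n₁ (P₁? ∘ (j ◂_)) * K ≤ countFuns M N (Q? ∘ ((j ↑ˡ n₂) ◂_))
  combine-tail j = countFuns-⊕ m₁ _ P₂? _ (◂-respects resp₁ j) resp₂ (◂-respects respQ (j ↑ˡ n₂))
    λ g h P₁g P₂h → respQ (◂-⊕ j g h) (combine (j ◂ g) h P₁g P₂h)

countFuns-cast : ∀ {m m′ n n′} (m≡m′ : m ≡ m′) (n≡n′ : n ≡ n′) {Q : Pred (Fin m′ → Fin n′) p} (Q? : Decidable Q) →
  Q Respects _≗_ → countFuns m n (λ f → Q? (cast n≡n′ ∘ f ∘ cast (sym m≡m′))) ≤ countFuns m′ n′ Q?
countFuns-cast {m = m} {n = n} refl refl Q? resp =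
  count-mono _ Q? (λ {f} → resp λ i → trans (cast-is-id refl _) (cong f (cast-is-id refl i))) (allFuns m n)

data ++-View (m n : ℕ) : Fin (m + n) → Set where
  left  : (x : Fin m) → ++-View m n (x ↑ˡ n)
  right : (y : Fin n) → ++-View m n (m ↑ʳ y)

++-view : ∀ m n (i : Fin (m + n)) → ++-View m n i
++-view zero    n i        = right i
++-view (suc m) n fzero    = left fzero
++-view (suc m) n (fsuc i) with ++-view m n i
... | left x  = left (fsuc x)
... | right y = right y

module _ (g : Fin m₁ → Fin n₁) (h : Fin m₂ → Fin n₂) where

  toℕ-⊕-↑ˡ : ∀ x → toℕ ((g ⊕ h) (x ↑ˡ m₂)) ≡ toℕ (g x)
  toℕ-⊕-↑ˡ x = trans (cong toℕ (lookup-++ˡ (λ x → g x ↑ˡ n₂) (λ y → n₁ ↑ʳ h y) x)) (toℕ-↑ˡ (g x) n₂)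

  toℕ-⊕-↑ʳ : ∀ y → toℕ ((g ⊕ h) (m₁ ↑ʳ y)) ≡ n₁ + toℕ (h y)
  toℕ-⊕-↑ʳ y = trans (cong toℕ (lookup-++ʳ (λ x → g x ↑ˡ n₂) (λ y → n₁ ↑ʳ h y) y)) (toℕ-↑ʳ n₁ (h y))

  StrictlyIncreasing-⊕ : StrictlyIncreasing g → StrictlyIncreasing h → StrictlyIncreasing (g ⊕ h)
  StrictlyIncreasing-⊕ g↑ h↑ i j i<j with ++-view m₁ m₂ i | ++-view m₁ m₂ j
  ... | left x  | left y  = subst₂ _<_ (sym (toℕ-⊕-↑ˡ x)) (sym (toℕ-⊕-↑ˡ y))
                              (g↑ x y (subst₂ _<_ (toℕ-↑ˡ x m₂) (toℕ-↑ˡ y m₂) i<j))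
  ... | left x  | right y = subst₂ _<_ (sym (toℕ-⊕-↑ˡ x)) (sym (toℕ-⊕-↑ʳ y))
                              (<-≤-trans (toℕ<n (g x)) (m≤m+n n₁ _))
  ... | right x | left y  = contradiction i<j (≤⇒≯ (begin
                              toℕ (y ↑ˡ m₂) ≡⟨ toℕ-↑ˡ y m₂ ⟩
                              toℕ y         ≤⟨ <⇒≤ (toℕ<n y) ⟩
                              m₁            ≤⟨ m≤m+n m₁ _ ⟩
                              m₁ + toℕ x    ≡⟨ toℕ-↑ʳ m₁ x ⟨
                              toℕ (m₁ ↑ʳ x) ∎))
    where open ≤-Reasoning
  ... | right x | right y = subst₂ _<_ (sym (toℕ-⊕-↑ʳ x)) (sym (toℕ-⊕-↑ʳ y))
                              (+-monoʳ-< n₁ (h↑ x y (+-cancelˡ-< m₁ _ _ (subst₂ _<_ (toℕ-↑ʳ m₁ x) (toℕ-↑ʳ m₁ y) i<j))))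

⧺-∘-⊕ : {a₁ : Vector A m₁} {a₂ : Vector A m₂} {b₁ : Vector A n₁} {b₂ : Vector A n₂}
        {g : Fin m₁ → Fin n₁} {h : Fin m₂ → Fin n₂} →
  a₁ ≗ b₁ ∘ g → a₂ ≗ b₂ ∘ h → a₁ ⧺ a₂ ≗ (b₁ ⧺ b₂) ∘ (g ⊕ h)
⧺-∘-⊕ {m₁ = m₁} {b₁ = b₁} {b₂} {g} {h} a₁≗ a₂≗ i with splitAt m₁ i
... | inj₁ x = trans (a₁≗ x) (sym (lookup-++ˡ b₁ b₂ (g x)))
... | inj₂ y = trans (a₂≗ y) (sym (lookup-++ʳ b₁ b₂ (h y)))

StrictlyIncreasing-cast : ∀ {m m′ n n′} (m′≡m : m′ ≡ m) (n≡n′ : n ≡ n′) {f : Fin m → Fin n} →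
  StrictlyIncreasing f → StrictlyIncreasing (cast n≡n′ ∘ f ∘ cast m′≡m)
StrictlyIncreasing-cast m′≡m n≡n′ {f} f↑ i j i<j =
  subst₂ _<_ (sym (toℕ-cast n≡n′ (f (cast m′≡m i)))) (sym (toℕ-cast n≡n′ (f (cast m′≡m j))))
    (f↑ _ _ (subst₂ _<_ (sym (toℕ-cast m′≡m i)) (sym (toℕ-cast m′≡m j)) i<j))

lookup-++ : (xs ys : List A) → lookup (xs ++ ys) ∘ cast (sym (length-++ xs)) ≗ lookup xs ⧺ lookup ys
lookup-++ []       ys i        = cong (lookup ys) (cast-is-id _ i)
lookup-++ (x ∷ xs) ys fzero    = refl
lookup-++ (x ∷ xs) ys (fsuc i) = trans (lookup-++ xs ys i) (sym ([,]-map (splitAt (length xs) i)))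

IsOccurrence-respects-≗ : (v w : Word k) → IsOccurrence v w Respects _≗_
IsOccurrence-respects-≗ v w {f} {f′} f≗f′ (f↑ , v≗) =
  (λ i j i<j → subst₂ _<_ (cong toℕ (f≗f′ i)) (cong toℕ (f≗f′ j)) (f↑ i j i<j)) ,
  (λ i → trans (v≗ i) (cong (lookup w) (f≗f′ i)))

module _ (v₁ v₂ w₁ w₂ : Word k) where

  private
    |v| = length-++ v₁ {v₂}
    |w| = length-++ w₁ {w₂}

  glue : (Fin (length v₁ + length v₂) → Fin (length w₁ + length w₂)) →
         Fin (length (v₁ ++ v₂)) → Fin (length (w₁ ++ w₂))
  glue f = cast (sym |w|) ∘ f ∘ cast |v|

  IsOccurrence-++ : ∀ {g h} → IsOccurrence v₁ w₁ g → IsOccurrence v₂ w₂ h →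
                    IsOccurrence (v₁ ++ v₂) (w₁ ++ w₂) (glue (g ⊕ h))
  IsOccurrence-++ {g} {h} (g↑ , v₁≗) (h↑ , v₂≗) =
    StrictlyIncreasing-cast |v| (sym |w|) (StrictlyIncreasing-⊕ g h g↑ h↑) , λ i → begin
      lookup (v₁ ++ v₂) i                                           ≡⟨ cong (lookup (v₁ ++ v₂)) (cast-involutive _ |v| i) ⟨
      lookup (v₁ ++ v₂) (cast (sym |v|) (cast |v| i))               ≡⟨ lookup-++ v₁ v₂ (cast |v| i) ⟩
      (lookup v₁ ⧺ lookup v₂) (cast |v| i)                          ≡⟨ ⧺-∘-⊕ {b₁ = lookup w₁} {lookup w₂} {g} {h} v₁≗ v₂≗ (cast |v| i) ⟩
      (lookup w₁ ⧺ lookup w₂) ((g ⊕ h) (cast |v| i))                ≡⟨ lookup-++ w₁ w₂ _ ⟨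
      lookup (w₁ ++ w₂) (glue (g ⊕ h) i)                            ∎
    where open ≡-Reasoning

  glue-cong : ∀ {f f′} → f ≗ f′ → glue f ≗ glue f′
  glue-cong f≗f′ i = cong (cast (sym |w|)) (f≗f′ (cast |v| i))

  M₂-++ : M₂ v₁ w₁ * M₂ v₂ w₂ ≤ M₂ (v₁ ++ v₂) (w₁ ++ w₂)
  M₂-++ = ≤-trans
    (countFuns-⊕ (length v₁) (isOccurrence? v₁ w₁) (isOccurrence? v₂ w₂) (isOccurrence? (v₁ ++ v₂) (w₁ ++ w₂) ∘ glue)
      (IsOccurrence-respects-≗ v₁ w₁) (IsOccurrence-respects-≗ v₂ w₂)
      (IsOccurrence-respects-≗ (v₁ ++ v₂) (w₁ ++ w₂) ∘ glue-cong) (λ _ _ → IsOccurrence-++))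
    (countFuns-cast (sym |v|) (sym |w|) (isOccurrence? (v₁ ++ v₂) (w₁ ++ w₂))
      (IsOccurrence-respects-≗ (v₁ ++ v₂) (w₁ ++ w₂)))

mainTheorem5 : (k : ℕ) (w₁ w₂ : Word k) (a b c : ℕ) →
    IsM w₁ a → IsM w₂ b → IsM (w₁ ++ w₂) c → a * b ≤ c
mainTheorem5 k w₁ w₂ a b c ((v₁ , M₂v₁w₁≡a) , _) ((v₂ , M₂v₂w₂≡b) , _) (_ , c-max) = begin
  a * b                              ≡⟨ cong₂ _*_ M₂v₁w₁≡a M₂v₂w₂≡b ⟨
  M₂ v₁ w₁ * M₂ v₂ w₂                ≤⟨ M₂-++ v₁ v₂ w₁ w₂ ⟩
  M₂ (v₁ ++ v₂) (w₁ ++ w₂)           ≤⟨ c-max (v₁ ++ v₂) ⟩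
  c                                  ∎
  where open ≤-Reasoning
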